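{- Let $\mathcal V$ be a regular vine on a finite set $A$ with $|A|\ge2$, and let $A\setminus\{a_1\}$ and $A\setminus\{a_2\}$ ($a_1\ne a_2$) be the two elements covered by $A$ in $\mathcal V$. For $i\in\{1,2\}$ let $\mathcal V_i=\{S\in\mathcal V:S\subseteq A\setminus\{a_i\}\}$ and let $\mathcal V'=\mathcal V_1\cap\mathcal V_2$. If $\mathcal V$ is a D-vine (resp. a C-vine), then $\mathcal V_1$, $\mathcal V_2$ and $\mathcal V'$ are D-vines (resp. C-vines).
   Context: A regular vine on an $m$-element set $X$ is an induced subposet $\mathcal V$ of $(2^X,\subseteq)$ such that (1) all maximal chains have length $m-1$ and minimal elements have rank 1; (2) $\mathcal V$ has exactly $m$ minimal elements (the singletons; the maximum is $X$); rank = cardinality, $\mathcal V(i)$ = elements of rank $i$; (3) every non-minimal element covers exactly two elements; (4) for $1\le i\le m-1$, the graph on $\mathcal V(i)$ whose edges are the elements of $\mathcal V(i+1)$, each joining the two elements it covers (the $i$-th associated tree), is a tree; (5) if two elements of $\mathcal V(i)$, $i\ge2$, are covered by a common element, they cover a common element. A D-vine (resp. C-vine) is a regular vine all of whose associated trees are path graphs (resp. star graphs). Known fact: $\mathcal V_1,\mathcal V_2,\mathcal V'$ are regular vines on $A\setminus\{a_1\}$, $A\setminus\{a_2\}$, $A\setminus\{a_1,a_2\}$ respectively. -}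

module Defs where

open import Data.Nat using (ℕ; suc; _≤_; _<_)
open import Data.Bool using (Bool; true; _∧_)
open import Data.Fin using (Fin)
open import Data.Fin.Subset using (Subset; _∈_; _⊆_; _⊂_; ⁅_⁆; ∣_∣; _-_)
open import Data.Fin.Subset.Properties using (_⊆?_)
open import Data.List using (List; []; _∷_; _++_; length; last)
import Data.List.Membership.Propositional as LM
open import Data.List.Relation.Unary.Unique.Propositional using (Unique)
open import Data.List.Relation.Unary.Linked using (Linked)
open import Data.Maybe using (just)
open import Data.Empty using (⊥)
open import Data.Product using (Σ; ∃; ∃-syntax; _×_; _,_)
open import Data.Sum using (_⊎_)
open import Relation.Nullary using (¬_)
open import Relation.Nullary.Decidable using (⌊_⌋)
open import Relation.Binary.PropositionalEquality using (_≡_; _≢_)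
open import Function.Bundles using (_⇔_)

module _ {A : Set} where

  data Reach (E : A → A → Set) : A → A → Set where
    here : ∀ {u} → Reach E u u
    step : ∀ {u v w} → E u v → Reach E v w → Reach E u w

  Connected : (A → Set) → (A → A → Set) → Set
  Connected Vert E = ∀ u v → Vert u → Vert v → Reach E u v

  IsCycle : (A → Set) → (A → A → Set) → List A → Set
  IsCycle Vert E [] = ⊥
  IsCycle Vert E (v ∷ vs) =
    3 ≤ length (v ∷ vs) × Unique (v ∷ vs) × (∀ w → w LM.∈ (v ∷ vs) → Vert w)
    × Linked E (v ∷ vs) × Σ A (λ l → last (v ∷ vs) ≡ just l × E l v)

  Acyclic : (A → Set) → (A → A → Set) → Set
  Acyclic Vert E = ∀ cs → ¬ IsCycle Vert E cs

  IsTree : (A → Set) → (A → A → Set) → Set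
  IsTree Vert E = Connected Vert E × Acyclic Vert E

  Consecutive : List A → A → A → Set
  Consecutive vs u w = ∃[ xs ] ∃[ ys ] (vs ≡ xs ++ u ∷ w ∷ ys ⊎ vs ≡ xs ++ w ∷ u ∷ ys)

  IsPathGraph : (A → Set) → (A → A → Set) → Set
  IsPathGraph Vert E = ∃[ vs ] Unique vs × (∀ v → Vert v ⇔ v LM.∈ vs)
                         × (∀ u w → E u w ⇔ Consecutive vs u w)

  IsStarGraph : (A → Set) → (A → A → Set) → Set
  IsStarGraph Vert E = ∃[ c ] Vert c ×
    (∀ u w → E u w ⇔ ((u ≡ c × w ≢ c × Vert w) ⊎ (w ≡ c × u ≢ c × Vert u)))

Family : ℕ → Set
Family n = Subset n → Bool

module _ {n : ℕ} where

  _∈ᶠ_ : Subset n → Family n → Set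
  S ∈ᶠ V = V S ≡ true

  Covers : Family n → Subset n → Subset n → Set
  Covers V S T = S ∈ᶠ V × T ∈ᶠ V × T ⊂ S
                 × (∀ U → U ∈ᶠ V → T ⊂ U → ¬ (U ⊂ S))

  Minimal : Family n → Subset n → Set
  Minimal V T = T ∈ᶠ V × (∀ U → U ∈ᶠ V → ¬ (U ⊂ T))

  -- V(i): elements of rank (= cardinality) i
  Level : Family n → ℕ → Subset n → Set
  Level V i T = T ∈ᶠ V × ∣ T ∣ ≡ i

  -- i-th associated tree: vertices V(i), edges the elements of V(i+1),
  -- each joining the two elements it covers
  Edge : Family n → ℕ → Subset n → Subset n → Set
  Edge V i T₁ T₂ = T₁ ≢ T₂ × ∃[ S ] (Level V (suc i) S × Covers V S T₁ × Covers V S T₂)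

  record IsRegularVine (X : Subset n) (V : Family n) : Set where
    field
      sub        : ∀ S → S ∈ᶠ V → S ⊆ X
      top        : X ∈ᶠ V
      minimal    : ∀ S → Minimal V S ⇔ (∃[ x ] (x ∈ X × S ≡ ⁅ x ⁆))
      graded     : ∀ S T → Covers V S T → ∣ S ∣ ≡ suc ∣ T ∣
      twoCovers  : ∀ S → S ∈ᶠ V → ¬ Minimal V S →
                   ∃[ T₁ ] ∃[ T₂ ] (T₁ ≢ T₂ × Covers V S T₁ × Covers V S T₂
                     × (∀ T → Covers V S T → T ≡ T₁ ⊎ T ≡ T₂))
      trees      : ∀ i → 1 ≤ i → i < ∣ X ∣ → IsTree (Level V i) (Edge V i)
      proximity  : ∀ i → 2 ≤ i → ∀ T₁ T₂ → Level V i T₁ → Level V i T₂ → T₁ ≢ T₂ →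
                   (∃[ S ] (Covers V S T₁ × Covers V S T₂)) →
                   ∃[ U ] (Covers V T₁ U × Covers V T₂ U)

  record IsDVine (X : Subset n) (V : Family n) : Set where
    field
      regular : IsRegularVine X V
      paths   : ∀ i → 1 ≤ i → i < ∣ X ∣ → IsPathGraph (Level V i) (Edge V i)

  record IsCVine (X : Subset n) (V : Family n) : Set where
    field
      regular : IsRegularVine X V
      stars   : ∀ i → 1 ≤ i → i < ∣ X ∣ → IsStarGraph (Level V i) (Edge V i)

  restrict : Family n → Subset n → Family n
  restrict V Y S = V S ∧ ⌊ S ⊆? Y ⌋

{-# OPTIONS --safe #-}
-- Restricting a regular vine V to any R ∈ V gives a regular vine on R. The crux is that every
-- T ∈ V with T ⊆ R descends from R along a chain of covers. Argue by induction on ∣ T ∣: the two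
-- elements T₁, T₂ covered by T descend from R. By proximity, the two ends of an edge at level
-- j + 1 cover a common element, so a walk between descendants of R at level j + 1 yields a walk
-- between their children at level j; going down from R, T₁ and T₂ are therefore joined in their
-- level tree by a walk along edges that descend from R. In a tree such a walk, closed up by the
-- edge T, must be that edge itself, so T descends from R.
-- Hence every level graph of the restriction is the induced subgraph of the level tree of V on
-- the subsets of R, and it is connected. A connected induced subgraph of a path is a path (the
-- filtered vertex list) and one of a star is a star, which settles the D- and C-vine cases.
-- Finally, if ∣ A ∣ ≥ 3 then by proximity A - a₁ and A - a₂ cover a common element, which can
-- only be A - a₁ - a₂; so A - a₁ - a₂ ∈ V as well.
module Submission where

open import Defs
open import Data.Empty using (⊥; ⊥-elim)
open import Data.List.Relation.Unary.Unique.Propositional using (Unique)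
open import Data.Nat using (ℕ; zero; suc; _+_; _∸_; _≤_; _<_; z≤n; s≤s)
open import Data.Nat.Properties
  using (suc-injective; +-suc; m∸n+n≡m; <⇒≤; ≤-pred; 0≢1+n; n≮0; <-irrefl; <-≤-trans; ≰⇒>; _≤?_)
open import Data.Product as Product using (∃; ∃-syntax; _×_; _,_; proj₁; proj₂)
open import Data.Sum as Sum using (_⊎_; inj₁; inj₂; [_,_])
open import Function using (_∘_)
open import Function.Bundles using (_⇔_; mk⇔; Equivalence)
open import Relation.Binary using (DecidableEquality)
open import Relation.Binary.PropositionalEquality using (_≡_; _≢_; refl; sym; trans; cong; subst)
open import Relation.Nullary using (¬_; yes; no; contradiction)

module Graph {A : Set} where
  open import Data.List using (List; []; _∷_; _++_; length; last; filter)
  open import Data.List.Properties using (filter-accept)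
  open import Data.List.Membership.Propositional using (_∈_)
  open import Data.List.Membership.Propositional.Properties using (∈-filter⁺; ∈-filter⁻; ∈-++⁺ʳ)
  open import Data.List.Relation.Unary.Any as Any using (here; there)
  open import Data.List.Relation.Unary.All as All using ([]; _∷_)
  open import Data.List.Relation.Unary.All.Properties using (¬Any⇒All¬)
  open import Data.List.Relation.Unary.AllPairs using ([]; _∷_)
  import Data.List.Relation.Unary.Unique.Propositional.Properties as Unique
  open import Data.List.Relation.Unary.Linked as Linked using (Linked; [-]; _∷_)
  open import Data.Maybe using (just)
  open import Relation.Unary using (Decidable)
  open Equivalence

  reach-trans : ∀ {E : A → A → Set} {u v w} → Reach E u v → Reach E v w → Reach E u w
  reach-trans here q = q
  reach-trans (step e p) q = step e (reach-trans p q)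

  reach-map : ∀ {E F : A → A → Set} → (∀ {u v} → E u v → F u v) → ∀ {u v} → Reach E u v → Reach F u v
  reach-map f here = here
  reach-map f (step e p) = step (f e) (reach-map f p)

  isCycle-map : ∀ {Vert Vert' : A → Set} {E E' : A → A → Set} →
                (∀ {u} → Vert u → Vert' u) → (∀ {u v} → E u v → E' u v) →
                ∀ cs → IsCycle Vert E cs → IsCycle Vert' E' cs
  isCycle-map f g (_ ∷ _) (3≤ , un , vert , linked , l , last≡ , e) =
    3≤ , un , (λ w w∈ → f (vert w w∈)) , Linked.map g linked , l , last≡ , g e

  data Walk (E : A → A → Set) : A → A → List A → Set where
    end : ∀ {u} → Walk E u u (u ∷ [])
    _◅_ : ∀ {u v w ps} → E u v → Walk E v w ps → Walk E u w (u ∷ ps)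

  infixr 5 _◅_

  module _ {E : A → A → Set} where

    walk-map : ∀ {F : A → A → Set} → (∀ {u v} → E u v → F u v) →
               ∀ {u v ps} → Walk E u v ps → Walk F u v ps
    walk-map f end = end
    walk-map f (e ◅ p) = f e ◅ walk-map f p

    walk-length : ∀ {u v ps} → Walk E u v ps → 1 ≤ length ps
    walk-length end = s≤s z≤n
    walk-length (_ ◅ _) = s≤s z≤n

    walk-last : ∀ {u v ps} → Walk E u v ps → last ps ≡ just v
    walk-last end = refl
    walk-last (_ ◅ end) = refl
    walk-last (_ ◅ p@(_ ◅ _)) = walk-last p

    walk-linked : ∀ {u v ps} → Walk E u v ps → Linked E ps
    walk-linked end = [-]
    walk-linked (e ◅ end) = e ∷ [-]
    walk-linked (e ◅ p@(_ ◅ _)) = e ∷ walk-linked p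

    walk-vertices : ∀ {Vert : A → Set} → (∀ {a b} → E a b → Vert b) →
                    ∀ {u v ps} → Vert u → Walk E u v ps → ∀ w → w ∈ ps → Vert w
    walk-vertices _ vu end _ (here refl) = vu
    walk-vertices _ vu (_ ◅ _) _ (here refl) = vu
    walk-vertices E⇒Vert vu (e ◅ p) w (there w∈ps) = walk-vertices E⇒Vert (E⇒Vert e) p w w∈ps

    simpleWalk+edge⇒cycle : ∀ {Vert : A → Set} → (∀ {a b} → E a b → Vert b) →
                            ∀ {u v ps} → Vert u → Walk E u v ps → Unique ps → 3 ≤ length ps → E v u →
                            IsCycle Vert E ps
    simpleWalk+edge⇒cycle _ _ end _ (s≤s ()) _
    simpleWalk+edge⇒cycle E⇒Vert vu p@(_ ◅ _) un 3≤ e =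
      3≤ , un , walk-vertices E⇒Vert vu p , walk-linked p , _ , walk-last p , e

    walk-suffix : ∀ {u v w ps} → Walk E u v ps → w ∈ ps → Unique ps → ∃[ qs ] (Walk E w v qs × Unique qs)
    walk-suffix p@end (here refl) un = _ , p , un
    walk-suffix p@(_ ◅ _) (here refl) un = _ , p , un
    walk-suffix (_ ◅ p) (there w∈ps) (_ ∷ un) = walk-suffix p w∈ps un

    reach⇒simpleWalk : DecidableEquality A → ∀ {u v} → Reach E u v → ∃[ ps ] (Walk E u v ps × Unique ps)
    reach⇒simpleWalk _≟_ here = _ , end , [] ∷ []
    reach⇒simpleWalk _≟_ (step {u} e r) with reach⇒simpleWalk _≟_ r
    ... | ps , p , un with Any.any? (u ≟_) ps
    ...   | yes u∈ps = walk-suffix p u∈ps un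
    ...   | no u∉ps = u ∷ ps , e ◅ p , ¬Any⇒All¬ ps u∉ps ∷ un

  data Adjacent : List A → A → A → Set where
    first  : ∀ {u w ys} → Adjacent (u ∷ w ∷ ys) u w
    first˘ : ∀ {u w ys} → Adjacent (w ∷ u ∷ ys) u w
    skip   : ∀ {x ys u w} → Adjacent ys u w → Adjacent (x ∷ ys) u w

  adjacent-sym : ∀ {vs u w} → Adjacent vs u w → Adjacent vs w u
  adjacent-sym first = first˘
  adjacent-sym first˘ = first
  adjacent-sym (skip a) = skip (adjacent-sym a)

  adjacent-++ʳ : ∀ xs {ys u w} → Adjacent ys u w → Adjacent (xs ++ ys) u w
  adjacent-++ʳ [] a = a
  adjacent-++ʳ (x ∷ xs) a = skip (adjacent-++ʳ xs a)

  consecutive⇒adjacent : ∀ {vs u w} → Consecutive vs u w → Adjacent vs u w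
  consecutive⇒adjacent (xs , _ , inj₁ refl) = adjacent-++ʳ xs first
  consecutive⇒adjacent (xs , _ , inj₂ refl) = adjacent-++ʳ xs first˘

  adjacent⇒consecutive : ∀ {vs u w} → Adjacent vs u w → Consecutive vs u w
  adjacent⇒consecutive first = [] , _ , inj₁ refl
  adjacent⇒consecutive first˘ = [] , _ , inj₂ refl
  adjacent⇒consecutive {x ∷ _} (skip a) with adjacent⇒consecutive a
  ... | xs , ys , eq = x ∷ xs , ys , Sum.map (cong (x ∷_)) (cong (x ∷_)) eq

  adjacent⇒∈ : ∀ {vs u w} → Adjacent vs u w → u ∈ vs × w ∈ vs
  adjacent⇒∈ first = here refl , there (here refl)
  adjacent⇒∈ first˘ = there (here refl) , here refl
  adjacent⇒∈ (skip a) = Product.map there there (adjacent⇒∈ a)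

  adjacent-uncons : ∀ {x ys u w} → Adjacent (x ∷ ys) u w →
                    (u ≡ x × ∃[ ys' ] (ys ≡ w ∷ ys')) ⊎ (w ≡ x × ∃[ ys' ] (ys ≡ u ∷ ys')) ⊎ Adjacent ys u w
  adjacent-uncons first = inj₁ (refl , _ , refl)
  adjacent-uncons first˘ = inj₂ (inj₁ (refl , _ , refl))
  adjacent-uncons (skip a) = inj₂ (inj₂ a)

  unique-disjoint : ∀ (L : List A) {M y} → Unique (L ++ M) → y ∈ L → y ∈ M → ⊥
  unique-disjoint (_ ∷ L) (x∉ ∷ _) (here refl) y∈M = All.lookup x∉ (∈-++⁺ʳ L y∈M) refl
  unique-disjoint (_ ∷ L) (_ ∷ un) (there y∈L) y∈M = unique-disjoint L un y∈L y∈M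

  adjacent-leaves-prefix : ∀ (L : List A) {z M u w} → Unique (L ++ z ∷ M) → u ∈ L →
                           Adjacent (L ++ z ∷ M) u w → w ∈ L ⊎ w ≡ z
  adjacent-leaves-prefix (_ ∷ []) _ _ first = inj₂ refl
  adjacent-leaves-prefix (_ ∷ _ ∷ _) _ _ first = inj₁ (there (here refl))
  adjacent-leaves-prefix (_ ∷ []) _ _ first˘ = inj₁ (here refl)
  adjacent-leaves-prefix (_ ∷ _ ∷ _) _ _ first˘ = inj₁ (here refl)
  adjacent-leaves-prefix (_ ∷ L) (x∉ ∷ _) (here refl) (skip a) =
    ⊥-elim (All.lookup x∉ (proj₁ (adjacent⇒∈ a)) refl)
  adjacent-leaves-prefix (_ ∷ L) (_ ∷ un) (there u∈L) (skip a) =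
    Sum.map₁ there (adjacent-leaves-prefix L un u∈L a)

  module _ {P : A → Set} (P? : Decidable P) where

    Separated : List A → A → A → Set
    Separated vs u w = ∃[ L ] ∃[ z ] ∃[ M ] (vs ≡ L ++ z ∷ M × ¬ P z × u ∈ L × w ∈ M)

    separated-∷ : ∀ {x vs u w} → Separated vs u w → Separated (x ∷ vs) u w
    separated-∷ {x} (L , z , M , refl , ¬pz , u∈L , w∈M) = x ∷ L , z , M , refl , ¬pz , there u∈L , w∈M

    module _ {E : A → A → Set} {L : List A} {z : A} {M : List A} (un : Unique (L ++ z ∷ M)) (¬pz : ¬ P z)
             (E⇒adjacent : ∀ {u w} → E u w → Adjacent (L ++ z ∷ M) u w × P w) where

      reach-stays-in-prefix : ∀ {u y} → u ∈ L → Reach E u y → y ∈ L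
      reach-stays-in-prefix u∈L here = u∈L
      reach-stays-in-prefix u∈L (step e r) with adjacent-leaves-prefix L un u∈L (proj₁ (E⇒adjacent e))
      ... | inj₁ w∈L = reach-stays-in-prefix w∈L r
      ... | inj₂ refl = ⊥-elim (¬pz (proj₂ (E⇒adjacent e)))

    separated⇒unreachable : ∀ {E : A → A → Set} {vs u w} → Unique vs →
                            (∀ {a b} → E a b → Adjacent vs a b × P b) → Separated vs u w → ¬ Reach E u w
    separated⇒unreachable un E⇒adjacent (L , _ , _ , refl , ¬pz , u∈L , w∈M) r =
      unique-disjoint L un (reach-stays-in-prefix un ¬pz E⇒adjacent u∈L r) (there w∈M)

    filter-accept₂ : ∀ {x y xs} → P x → P y → filter P? (x ∷ y ∷ xs) ≡ x ∷ y ∷ filter P? xs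
    filter-accept₂ px py = trans (filter-accept P? px) (cong (_ ∷_) (filter-accept P? py))

    adjacent-filter⁺ : ∀ {vs u w} → Adjacent vs u w → P u → P w → Adjacent (filter P? vs) u w
    adjacent-filter⁺ first pu pw = subst (λ l → Adjacent l _ _) (sym (filter-accept₂ pu pw)) first
    adjacent-filter⁺ first˘ pu pw = subst (λ l → Adjacent l _ _) (sym (filter-accept₂ pw pu)) first˘
    adjacent-filter⁺ {x ∷ _} (skip a) pu pw with P? x
    ... | yes _ = skip (adjacent-filter⁺ a pu pw)
    ... | no _ = adjacent-filter⁺ a pu pw

    filter-head : ∀ {x vs w ys} → filter P? vs ≡ w ∷ ys → Adjacent (x ∷ vs) x w ⊎ Separated (x ∷ vs) x w
    filter-head {vs = v ∷ vs} eq with P? v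
    filter-head {vs = v ∷ vs} refl | yes _ = inj₁ first
    filter-head {x} {v ∷ vs} {w} eq | no ¬pv =
      inj₂ (x ∷ [] , v , vs , refl , ¬pv , here refl ,
            proj₁ (∈-filter⁻ P? (subst (w ∈_) (sym eq) (here refl))))

    adjacent-filter⁻ : ∀ vs {u w} → Adjacent (filter P? vs) u w →
                       Adjacent vs u w ⊎ Separated vs u w ⊎ Separated vs w u
    adjacent-filter⁻ (v ∷ vs) a with P? v
    ... | no _ = Sum.map skip (Sum.map separated-∷ separated-∷) (adjacent-filter⁻ vs a)
    ... | yes _ with adjacent-uncons a
    ...   | inj₁ (refl , _ , eq) = Sum.map₂ inj₁ (filter-head eq)
    ...   | inj₂ (inj₁ (refl , _ , eq)) = Sum.map adjacent-sym inj₂ (filter-head eq)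
    ...   | inj₂ (inj₂ a') = Sum.map skip (Sum.map separated-∷ separated-∷) (adjacent-filter⁻ vs a')

    module ConnectedInducedSubgraph {Vert Vert' : A → Set} {E E' : A → A → Set}
             (vert' : ∀ v → Vert' v ⇔ (Vert v × P v))
             (edge' : ∀ u w → E' u w ⇔ (E u w × P u × P w))
             (connected : Connected Vert' E') where

      -- Two vertices consecutive in the filtered list but not in vs are separated by a vertex
      -- outside P, which would disconnect them.
      isPathGraph : IsPathGraph Vert E → IsPathGraph Vert' E'
      isPathGraph (vs , un , vert , edge) = filter P? vs , Unique.filter⁺ P? un , vert″ , edge″
        where
          vert″ : ∀ v → Vert' v ⇔ v ∈ filter P? vs
          vert″ v = mk⇔ (λ v' → let (vv , pv) = to (vert' v) v' in ∈-filter⁺ P? (to (vert v) vv) pv)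
                        (λ v∈ → let (v∈vs , pv) = ∈-filter⁻ P? v∈ in from (vert' v) (from (vert v) v∈vs , pv))

          E'⇒adjacent : ∀ {u w} → E' u w → Adjacent vs u w × P u × P w
          E'⇒adjacent {u} {w} e' = let (e , pu , pw) = to (edge' u w) e' in
            consecutive⇒adjacent (to (edge u w) e) , pu , pw

          separated⇒⊥ : ∀ {u w} → Separated vs u w → Vert' u → Vert' w → ⊥
          separated⇒⊥ {u} {w} sep vu vw =
            separated⇒unreachable un (Product.map₂ proj₂ ∘ E'⇒adjacent) sep (connected u w vu vw)

          filtered⇒E' : ∀ {u w} → Adjacent (filter P? vs) u w → E' u w
          filtered⇒E' {u} {w} a = join (adjacent-filter⁻ vs a)
            where
              vu = from (vert″ u) (proj₁ (adjacent⇒∈ a))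
              vw = from (vert″ w) (proj₂ (adjacent⇒∈ a))
              join : Adjacent vs u w ⊎ Separated vs u w ⊎ Separated vs w u → E' u w
              join (inj₁ a') = from (edge' u w)
                (from (edge u w) (adjacent⇒consecutive a') ,
                 proj₂ (to (vert' u) vu) , proj₂ (to (vert' w) vw))
              join (inj₂ (inj₁ sep)) = ⊥-elim (separated⇒⊥ sep vu vw)
              join (inj₂ (inj₂ sep)) = ⊥-elim (separated⇒⊥ sep vw vu)

          edge″ : ∀ u w → E' u w ⇔ Consecutive (filter P? vs) u w
          edge″ u w = mk⇔
            (λ e' → let (a , pu , pw) = E'⇒adjacent e' in adjacent⇒consecutive (adjacent-filter⁺ a pu pw))
            (filtered⇒E' ∘ consecutive⇒adjacent)

      isStarGraph : ∃ Vert' → IsStarGraph Vert E → IsStarGraph Vert' E'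
      isStarGraph (t , vt) (c , vc , star) with P? c
      ... | yes pc = c , from (vert' c) (vc , pc) , λ u w → mk⇔ (E'⇒spoke u w) (spoke⇒E' u w)
        where
          E'⇒spoke : ∀ u w → E' u w → (u ≡ c × w ≢ c × Vert' w) ⊎ (w ≡ c × u ≢ c × Vert' u)
          E'⇒spoke u w e' with to (edge' u w) e'
          ... | e , pu , pw with to (star u w) e
          ...   | inj₁ (u≡c , w≢c , vw) = inj₁ (u≡c , w≢c , from (vert' w) (vw , pw))
          ...   | inj₂ (w≡c , u≢c , vu) = inj₂ (w≡c , u≢c , from (vert' u) (vu , pu))
          spoke⇒E' : ∀ u w → (u ≡ c × w ≢ c × Vert' w) ⊎ (w ≡ c × u ≢ c × Vert' u) → E' u w
          spoke⇒E' u w (inj₁ (refl , w≢c , vw)) = let (vw , pw) = to (vert' w) vw in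
            from (edge' u w) (from (star u w) (inj₁ (refl , w≢c , vw)) , pc , pw)
          spoke⇒E' u w (inj₂ (refl , u≢c , vu)) = let (vu , pu) = to (vert' u) vu in
            from (edge' u w) (from (star u w) (inj₂ (refl , u≢c , vu)) , pu , pc)
      ... | no ¬pc = t , vt , λ u w → mk⇔ (⊥-elim ∘ no-edge) (⊥-elim ∘ [ lone ∘ proj₂ , lone ∘ proj₂ ])
        where
          no-edge : ∀ {u w} → ¬ E' u w
          no-edge {u} {w} e' with to (edge' u w) e'
          ... | e , pu , pw with to (star u w) e
          ...   | inj₁ (refl , _) = ¬pc pu
          ...   | inj₂ (refl , _) = ¬pc pw
          lone : ∀ {w} → w ≢ t × Vert' w → ⊥
          lone {w} (w≢t , vw) with connected t w vt vw
          ... | here = w≢t refl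
          ... | step e _ = no-edge e

open Graph

open import Data.Bool using (true; false)
import Data.Bool.Properties as Bool
open import Data.Fin using (Fin; zero; suc)
import Data.Fin.Properties as Fin
open import Data.Fin.Subset using (Subset; inside; outside; _∈_; _∉_; _⊆_; _⊂_; ⁅_⁆; ∣_∣; _∪_; _-_; _─_)
open import Data.Fin.Subset.Properties
  using ( _⊆?_; drop-∷-⊆; ⊆-refl; ⊆-trans; p⊆q⇒∣p∣≤∣q∣; p⊂q⇒∣p∣<∣q∣; x∈⁅x⁆; x∈⁅y⁆⇒x≡y; ∣⁅x⁆∣≡1
        ; x∈p∪q⁻; p⊆p∪q; q⊆p∪q; x∈p∧x≢y⇒x∈p-y; p─q⊆p; x∈p⇒∣p-x∣<∣p∣)
open import Data.Vec using ([]; _∷_; here; there)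
open import Data.Vec.Properties using (≡-dec)

p⊆q∧∣q∣≤∣p∣⇒p≡q : ∀ {m} {p q : Subset m} → p ⊆ q → ∣ q ∣ ≤ ∣ p ∣ → p ≡ q
p⊆q∧∣q∣≤∣p∣⇒p≡q {p = []} {[]} _ _ = refl
p⊆q∧∣q∣≤∣p∣⇒p≡q {p = outside ∷ p} {outside ∷ q} p⊆q ∣q∣≤∣p∣ =
  cong (outside ∷_) (p⊆q∧∣q∣≤∣p∣⇒p≡q (drop-∷-⊆ p⊆q) ∣q∣≤∣p∣)
p⊆q∧∣q∣≤∣p∣⇒p≡q {p = outside ∷ p} {inside ∷ q} p⊆q ∣q∣≤∣p∣ =
  contradiction (<-≤-trans ∣q∣≤∣p∣ (p⊆q⇒∣p∣≤∣q∣ (drop-∷-⊆ p⊆q))) (<-irrefl refl)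
p⊆q∧∣q∣≤∣p∣⇒p≡q {p = inside ∷ p} {outside ∷ q} p⊆q _ with p⊆q here
... | ()
p⊆q∧∣q∣≤∣p∣⇒p≡q {p = inside ∷ p} {inside ∷ q} p⊆q (s≤s ∣q∣≤∣p∣) =
  cong (inside ∷_) (p⊆q∧∣q∣≤∣p∣⇒p≡q (drop-∷-⊆ p⊆q) ∣q∣≤∣p∣)

x∈p─q⇒x∉q : ∀ {n} {p q : Subset n} {x} → x ∈ p ─ q → x ∉ q
x∈p─q⇒x∉q {p = _ ∷ _} {outside ∷ _} here ()
x∈p─q⇒x∉q {p = _ ∷ _} {inside ∷ _} {zero} ()
x∈p─q⇒x∉q {p = _ ∷ _} {_ ∷ _} (there x∈p─q) (there x∈q) = x∈p─q⇒x∉q x∈p─q x∈q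

module _ {n : ℕ} where

  _≟ₛ_ : DecidableEquality (Subset n)
  _≟ₛ_ = ≡-dec Bool._≟_

  ∪-least : {p q r : Subset n} → p ⊆ r → q ⊆ r → p ∪ q ⊆ r
  ∪-least {p} {q} p⊆r q⊆r x∈p∪q = [ p⊆r , q⊆r ] (x∈p∪q⁻ p q x∈p∪q)

  x∈p-y⇒x≢y : ∀ {p : Subset n} {x y} → x ∈ p - y → x ≢ y
  x∈p-y⇒x≢y {y = y} x∈p-y refl = x∈p─q⇒x∉q x∈p-y (x∈⁅x⁆ y)

  p⊆q-x∧p⊆q-y⇒p⊆q-x-y : ∀ {p q : Subset n} {x y} → p ⊆ q - x → p ⊆ q - y → p ⊆ q - x - y
  p⊆q-x∧p⊆q-y⇒p⊆q-x-y p⊆q-x p⊆q-y z∈p = x∈p∧x≢y⇒x∈p-y (p⊆q-x z∈p) (x∈p-y⇒x≢y (p⊆q-y z∈p))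

  p-x-y⊆p-y : ∀ (p : Subset n) x y → p - x - y ⊆ p - y
  p-x-y⊆p-y p x y z∈ = x∈p∧x≢y⇒x∈p-y (p─q⊆p p ⁅ x ⁆ (p─q⊆p (p - x) ⁅ y ⁆ z∈)) (x∈p-y⇒x≢y z∈)

  ∈-restrict⁻ : ∀ (V : Family n) {Y S} → S ∈ᶠ restrict V Y → S ∈ᶠ V × S ⊆ Y
  ∈-restrict⁻ V {Y} {S} S∈ with V S | S ⊆? Y
  ... | true | yes S⊆Y = refl , S⊆Y
  ∈-restrict⁻ _ () | true | no _
  ∈-restrict⁻ _ () | false | _

  ∈-restrict⁺ : ∀ (V : Family n) {Y S} → S ∈ᶠ V → S ⊆ Y → S ∈ᶠ restrict V Y
  ∈-restrict⁺ V {Y} {S} S∈V S⊆Y with V S | S ⊆? Y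
  ... | true | yes _ = refl
  ... | true | no S⊈Y = contradiction (λ {x} → S⊆Y {x}) S⊈Y
  ∈-restrict⁺ _ () _ | false | _

  ∈-restrict²⁻ : ∀ (V : Family n) {A x y S} →
                 S ∈ᶠ restrict (restrict V (A - x)) (A - y) → S ∈ᶠ V × S ⊆ A - x - y
  ∈-restrict²⁻ V {A} {x} S∈ with ∈-restrict⁻ (restrict V (A - x)) S∈
  ... | S∈V₁ , S⊆A-y with ∈-restrict⁻ V S∈V₁
  ...   | S∈V , S⊆A-x = S∈V , p⊆q-x∧p⊆q-y⇒p⊆q-x-y S⊆A-x S⊆A-y

  ∈-restrict²⁺ : ∀ (V : Family n) {A x y S} →
                 S ∈ᶠ V → S ⊆ A - x - y → S ∈ᶠ restrict (restrict V (A - x)) (A - y)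
  ∈-restrict²⁺ V {A} {x} {y} S∈V S⊆ =
    ∈-restrict⁺ (restrict V (A - x)) (∈-restrict⁺ V S∈V (p─q⊆p (A - x) ⁅ y ⁆ ∘ S⊆)) (p-x-y⊆p-y A x y ∘ S⊆)

module RegularVineProperties {n : ℕ} {X : Subset n} {V : Family n} (vine : IsRegularVine X V) where
  open IsRegularVine vine
  open Equivalence

  module _ {S T : Subset n} (S⋗T : Covers V S T) where
    upper∈ : S ∈ᶠ V
    upper∈ = proj₁ S⋗T
    lower∈ : T ∈ᶠ V
    lower∈ = proj₁ (proj₂ S⋗T)
    lower⊂upper : T ⊂ S
    lower⊂upper = proj₁ (proj₂ (proj₂ S⋗T))
    lower⊆upper : T ⊆ S
    lower⊆upper = proj₁ lower⊂upper

  covers-level : ∀ {S T j} → Covers V S T → ∣ S ∣ ≡ suc j → Level V j T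
  covers-level S⋗T ∣S∣≡ = lower∈ S⋗T , suc-injective (trans (sym (graded _ _ S⋗T)) ∣S∣≡)

  minimal⇒∣∣≡1 : ∀ {S} → Minimal V S → ∣ S ∣ ≡ 1
  minimal⇒∣∣≡1 {S} m with to (minimal S) m
  ... | x , _ , refl = ∣⁅x⁆∣≡1 x

  1≤∣member∣ : ∀ {S} → S ∈ᶠ V → 1 ≤ ∣ S ∣
  1≤∣member∣ {S} S∈V with ∣ S ∣ in ∣S∣≡
  ... | suc _ = s≤s z≤n
  ... | zero = contradiction (trans (sym ∣S∣≡) (minimal⇒∣∣≡1 (S∈V , nothing-below))) 0≢1+n
    where
      nothing-below : ∀ U → U ∈ᶠ V → ¬ U ⊂ S
      nothing-below U _ U⊂S = n≮0 (subst (∣ U ∣ <_) ∣S∣≡ (p⊂q⇒∣p∣<∣q∣ U⊂S))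

  ∣∣≡1⇒minimal : ∀ {S} → S ∈ᶠ V → ∣ S ∣ ≡ 1 → Minimal V S
  ∣∣≡1⇒minimal {S} S∈V ∣S∣≡1 = S∈V , λ U U∈V U⊂S →
    contradiction (<-≤-trans (subst (∣ U ∣ <_) ∣S∣≡1 (p⊂q⇒∣p∣<∣q∣ U⊂S)) (1≤∣member∣ U∈V)) (<-irrefl refl)

  ∣∣≡2+⇒¬minimal : ∀ {S k} → ∣ S ∣ ≡ suc (suc k) → ¬ Minimal V S
  ∣∣≡2+⇒¬minimal ∣S∣≡ m with trans (sym ∣S∣≡) (minimal⇒∣∣≡1 m)
  ... | ()

  covers-union : ∀ {S T₁ T₂} → Covers V S T₁ → Covers V S T₂ → T₁ ≢ T₂ → S ≡ T₁ ∪ T₂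
  covers-union {S} {T₁} {T₂} S⋗T₁ S⋗T₂ T₁≢T₂ = sym (p⊆q∧∣q∣≤∣p∣⇒p≡q T₁∪T₂⊆S ∣S∣≤∣T₁∪T₂∣)
    where
      T₁∪T₂⊆S : T₁ ∪ T₂ ⊆ S
      T₁∪T₂⊆S = ∪-least (lower⊆upper S⋗T₁) (lower⊆upper S⋗T₂)
      ∣T₁∣≡∣T₂∣ : ∣ T₁ ∣ ≡ ∣ T₂ ∣
      ∣T₁∣≡∣T₂∣ = suc-injective (trans (sym (graded _ _ S⋗T₁)) (graded _ _ S⋗T₂))
      ∣T₁∣<∣T₁∪T₂∣ : ∣ T₁ ∣ < ∣ T₁ ∪ T₂ ∣
      ∣T₁∣<∣T₁∪T₂∣ with ∣ T₁ ∪ T₂ ∣ ≤? ∣ T₁ ∣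
      ... | no ∪≰T₁ = ≰⇒> ∪≰T₁
      ... | yes ∪≤T₁ = contradiction (trans T₁≡T₁∪T₂ (sym T₂≡T₁∪T₂)) T₁≢T₂
        where
          T₁≡T₁∪T₂ : T₁ ≡ T₁ ∪ T₂
          T₁≡T₁∪T₂ = p⊆q∧∣q∣≤∣p∣⇒p≡q (p⊆p∪q T₂) ∪≤T₁
          T₂≡T₁∪T₂ : T₂ ≡ T₁ ∪ T₂
          T₂≡T₁∪T₂ = p⊆q∧∣q∣≤∣p∣⇒p≡q (q⊆p∪q T₁ T₂) (subst (∣ T₁ ∪ T₂ ∣ ≤_) ∣T₁∣≡∣T₂∣ ∪≤T₁)
      ∣S∣≤∣T₁∪T₂∣ : ∣ S ∣ ≤ ∣ T₁ ∪ T₂ ∣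
      ∣S∣≤∣T₁∪T₂∣ = subst (_≤ ∣ T₁ ∪ T₂ ∣) (sym (graded _ _ S⋗T₁)) ∣T₁∣<∣T₁∪T₂∣

  ∈-lower : ∀ {S k x} → S ∈ᶠ V → ∣ S ∣ ≡ suc (suc k) → x ∈ S → ∃[ T ] (Covers V S T × x ∈ T)
  ∈-lower {S} S∈V ∣S∣≡ x∈S with twoCovers S S∈V (∣∣≡2+⇒¬minimal ∣S∣≡)
  ... | T₁ , T₂ , T₁≢T₂ , S⋗T₁ , S⋗T₂ , _ =
    [ (λ x∈T₁ → T₁ , S⋗T₁ , x∈T₁) , (λ x∈T₂ → T₂ , S⋗T₂ , x∈T₂) ]
      (x∈p∪q⁻ T₁ T₂ (subst (_ ∈_) (covers-union S⋗T₁ S⋗T₂ T₁≢T₂) x∈S))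

  edge⇒level : ∀ {j T₁ T₂} → Edge V j T₁ T₂ → Level V j T₂
  edge⇒level (_ , _ , (_ , ∣S∣≡) , _ , S⋗T₂) = covers-level S⋗T₂ ∣S∣≡

  data Descendant (R : Subset n) : Subset n → Set where
    self  : R ∈ᶠ V → Descendant R R
    below : ∀ {S T} → Covers V S T → Descendant R S → Descendant R T

  module _ {R : Subset n} where

    descendant∈ : ∀ {T} → Descendant R T → T ∈ᶠ V
    descendant∈ (self R∈V) = R∈V
    descendant∈ (below S⋗T _) = lower∈ S⋗T

    descendant⊆ : ∀ {T} → Descendant R T → T ⊆ R
    descendant⊆ (self _) x∈T = x∈T
    descendant⊆ (below S⋗T d) x∈T = descendant⊆ d (lower⊆upper S⋗T x∈T)

    covers-descendant< : ∀ {S T} → Covers V S T → Descendant R S → ∣ T ∣ < ∣ R ∣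
    covers-descendant< S⋗T d = <-≤-trans (p⊂q⇒∣p∣<∣q∣ (lower⊂upper S⋗T)) (p⊆q⇒∣p∣≤∣q∣ (descendant⊆ d))

    EdgeBelow : ℕ → Subset n → Subset n → Set
    EdgeBelow j T₁ T₂ = T₁ ≢ T₂ × ∃[ S ] (Level V (suc j) S × Covers V S T₁ × Covers V S T₂ × Descendant R S)

    edgeBelow⇒edge : ∀ {j T₁ T₂} → EdgeBelow j T₁ T₂ → Edge V j T₁ T₂
    edgeBelow⇒edge (T₁≢T₂ , S , lev , S⋗T₁ , S⋗T₂ , _) = T₁≢T₂ , S , lev , S⋗T₁ , S⋗T₂

    siblings-reach : ∀ {j S T₁ T₂} → Covers V S T₁ → Covers V S T₂ → ∣ S ∣ ≡ suc j → Descendant R S →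
                     Reach (EdgeBelow j) T₁ T₂
    siblings-reach {T₁ = T₁} {T₂} S⋗T₁ S⋗T₂ ∣S∣≡ d with T₁ ≟ₛ T₂
    ... | yes refl = here
    ... | no T₁≢T₂ = step (T₁≢T₂ , _ , (upper∈ S⋗T₁ , ∣S∣≡) , S⋗T₁ , S⋗T₂ , d) here

    reach-descend : ∀ {j} → 1 ≤ j → ∀ {S S' T T'} → Reach (EdgeBelow (suc j)) S S' →
                    Level V (suc j) S → Descendant R S → Covers V S T → Covers V S' T' →
                    Reach (EdgeBelow j) T T'
    reach-descend _ here (_ , ∣S∣≡) d S⋗T S⋗T' = siblings-reach S⋗T S⋗T' ∣S∣≡ d
    reach-descend {j} 1≤j (step (S≢S₁ , Q , (_ , ∣Q∣≡) , Q⋗S , Q⋗S₁ , dQ) r) levS d S⋗T S'⋗T'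
      with covers-level Q⋗S₁ ∣Q∣≡
    ... | levS₁ with proximity (suc j) (s≤s 1≤j) _ _ levS levS₁ S≢S₁ (Q , Q⋗S , Q⋗S₁)
    ...   | U , S⋗U , S₁⋗U =
      reach-trans (siblings-reach S⋗T S⋗U (proj₂ levS) d)
                  (reach-descend 1≤j r levS₁ (below Q⋗S₁ dQ) S₁⋗U S'⋗T')

    descendants-connected : ∀ {j T T'} → 1 ≤ j → Level V j T → Level V j T' →
                            Descendant R T → Descendant R T' → Reach (EdgeBelow j) T T'
    descendants-connected _ _ _ (self _) (self _) = here
    descendants-connected _ (_ , ∣R∣≡) (_ , ∣T'∣≡) (self _) (below S'⋗T' d') =
      contradiction (covers-descendant< S'⋗T' d') (<-irrefl (trans ∣T'∣≡ (sym ∣R∣≡)))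
    descendants-connected _ (_ , ∣T∣≡) (_ , ∣R∣≡) (below S⋗T d) (self _) =
      contradiction (covers-descendant< S⋗T d) (<-irrefl (trans ∣T∣≡ (sym ∣R∣≡)))
    descendants-connected 1≤j (_ , ∣T∣≡) (_ , ∣T'∣≡) (below S⋗T d) (below S'⋗T' d') =
      reach-descend 1≤j (descendants-connected (s≤s z≤n) levS levS' d d') levS d S⋗T S'⋗T'
      where
        levS = upper∈ S⋗T , trans (graded _ _ S⋗T) (cong suc ∣T∣≡)
        levS' = upper∈ S'⋗T' , trans (graded _ _ S'⋗T') (cong suc ∣T'∣≡)

    singleton-descendant : ∀ i {S x} → ∣ S ∣ ≡ i → Descendant R S → x ∈ S → Descendant R ⁅ x ⁆
    singleton-descendant zero ∣S∣≡0 d _ =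
      contradiction (subst (1 ≤_) ∣S∣≡0 (1≤∣member∣ (descendant∈ d))) λ ()
    singleton-descendant 1 {S} ∣S∣≡1 d x∈S with to (minimal S) (∣∣≡1⇒minimal (descendant∈ d) ∣S∣≡1)
    ... | y , _ , refl = subst (λ z → Descendant R ⁅ z ⁆) (sym (x∈⁅y⁆⇒x≡y y x∈S)) d
    singleton-descendant (suc (suc k)) ∣S∣≡ d x∈S =
      let (T , S⋗T , x∈T) = ∈-lower (descendant∈ d) ∣S∣≡ x∈S in
      singleton-descendant (suc k) (proj₂ (covers-level S⋗T ∣S∣≡)) (below S⋗T d) x∈T

  descendant-step : ∀ {R} k → (∀ {T} → T ∈ᶠ V → ∣ T ∣ ≡ suc k → T ⊆ R → Descendant R T) →
                    ∀ {T} → T ∈ᶠ V → ∣ T ∣ ≡ suc (suc k) → T ⊆ R → Descendant R T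
  descendant-step {R} k IH {T} T∈V ∣T∣≡ T⊆R with twoCovers T T∈V (∣∣≡2+⇒¬minimal ∣T∣≡)
  ... | T₁ , T₂ , T₁≢T₂ , T⋗T₁ , T⋗T₂ , _ =
    simple-walk⇒descendant T₁≢T₂ T⋗T₁ T⋗T₂ (reach⇒simpleWalk _≟ₛ_ (descendants-connected (s≤s z≤n) lev₁ lev₂ d₁ d₂))
    where
      lev₁ = covers-level T⋗T₁ ∣T∣≡
      lev₂ = covers-level T⋗T₂ ∣T∣≡
      d₁ = IH (proj₁ lev₁) (proj₂ lev₁) (⊆-trans (lower⊆upper T⋗T₁) T⊆R)
      d₂ = IH (proj₁ lev₂) (proj₂ lev₂) (⊆-trans (lower⊆upper T⋗T₂) T⊆R)
      tree : IsTree (Level V (suc k)) (Edge V (suc k))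
      tree = trees (suc k) (s≤s z≤n) (subst (_≤ ∣ X ∣) ∣T∣≡ (p⊆q⇒∣p∣≤∣q∣ (sub T T∈V)))
      simple-walk⇒descendant : ∀ {a b} → a ≢ b → Covers V T a → Covers V T b →
               ∃[ ps ] (Walk (EdgeBelow {R} (suc k)) a b ps × Unique ps) → Descendant R T
      simple-walk⇒descendant a≢b _ _ (_ , end , _) = ⊥-elim (a≢b refl)
      simple-walk⇒descendant a≢b T⋗a T⋗b (_ , (_ , S , _ , S⋗a , S⋗b , dS) ◅ end , _) =
        subst (Descendant R) (trans (covers-union S⋗a S⋗b a≢b) (sym (covers-union T⋗a T⋗b a≢b))) dS
      simple-walk⇒descendant a≢b T⋗a T⋗b (_ , p@(_ ◅ _ ◅ q) , un) =
        ⊥-elim (proj₂ tree _ (simpleWalk+edge⇒cycle edge⇒level (covers-level T⋗a ∣T∣≡)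
          (walk-map edgeBelow⇒edge p) un (s≤s (s≤s (walk-length q)))
          (a≢b ∘ sym , T , (T∈V , ∣T∣≡) , T⋗b , T⋗a)))

  subset-descendant : ∀ {R} → R ∈ᶠ V → ∀ i {T} → T ∈ᶠ V → ∣ T ∣ ≡ i → T ⊆ R → Descendant R T
  subset-descendant R∈V zero T∈V ∣T∣≡0 _ = contradiction (subst (1 ≤_) ∣T∣≡0 (1≤∣member∣ T∈V)) λ ()
  subset-descendant R∈V 1 {T} T∈V ∣T∣≡1 T⊆R with to (minimal T) (∣∣≡1⇒minimal T∈V ∣T∣≡1)
  ... | x , _ , refl = singleton-descendant _ refl (self R∈V) (T⊆R (x∈⁅x⁆ x))
  subset-descendant R∈V (suc (suc k)) = descendant-step k (subset-descendant R∈V (suc k))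

-- W is given by its members rather than as restrict V R, so that a restriction of a
-- restriction is covered as well.
module Restriction {n : ℕ} {X : Subset n} {V : Family n} (vine : IsRegularVine X V)
                   {R : Subset n} (R∈V : R ∈ᶠ V) {W : Family n}
                   (∈W⁻ : ∀ {S} → S ∈ᶠ W → S ∈ᶠ V × S ⊆ R)
                   (∈W⁺ : ∀ {S} → S ∈ᶠ V → S ⊆ R → S ∈ᶠ W) where
  open IsRegularVine vine
  open RegularVineProperties vine
  open Equivalence

  ∈W⇒∈V : ∀ {S} → S ∈ᶠ W → S ∈ᶠ V
  ∈W⇒∈V = proj₁ ∘ ∈W⁻

  ∈W⇒⊆R : ∀ {S} → S ∈ᶠ W → S ⊆ R
  ∈W⇒⊆R = proj₂ ∘ ∈W⁻

  ∣R∣≤∣X∣ : ∣ R ∣ ≤ ∣ X ∣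
  ∣R∣≤∣X∣ = p⊆q⇒∣p∣≤∣q∣ (sub R R∈V)

  coversW⇒coversV : ∀ {S T} → Covers W S T → Covers V S T
  coversW⇒coversV (S∈W , T∈W , T⊂S , nothing-between) =
    ∈W⇒∈V S∈W , ∈W⇒∈V T∈W , T⊂S ,
    λ U U∈V T⊂U U⊂S → nothing-between U (∈W⁺ U∈V (⊆-trans (proj₁ U⊂S) (∈W⇒⊆R S∈W))) T⊂U U⊂S

  coversV⇒coversW : ∀ {S T} → S ⊆ R → Covers V S T → Covers W S T
  coversV⇒coversW S⊆R (S∈V , T∈V , T⊂S , nothing-between) =
    ∈W⁺ S∈V S⊆R , ∈W⁺ T∈V (⊆-trans (proj₁ T⊂S) S⊆R) , T⊂S ,
    λ U U∈W → nothing-between U (∈W⇒∈V U∈W)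

  minimalW⇒minimalV : ∀ {S} → Minimal W S → Minimal V S
  minimalW⇒minimalV (S∈W , nothing-below) =
    ∈W⇒∈V S∈W , λ U U∈V U⊂S → nothing-below U (∈W⁺ U∈V (⊆-trans (proj₁ U⊂S) (∈W⇒⊆R S∈W))) U⊂S

  minimalV⇒minimalW : ∀ {S} → S ⊆ R → Minimal V S → Minimal W S
  minimalV⇒minimalW S⊆R (S∈V , nothing-below) = ∈W⁺ S∈V S⊆R , λ U U∈W → nothing-below U (∈W⇒∈V U∈W)

  minimalW⇔singleton : ∀ S → Minimal W S ⇔ (∃[ x ] (x ∈ R × S ≡ ⁅ x ⁆))
  minimalW⇔singleton S = mk⇔ singleton minimalW
    where
      singleton : Minimal W S → ∃[ x ] (x ∈ R × S ≡ ⁅ x ⁆)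
      singleton m with to (minimal S) (minimalW⇒minimalV m)
      ... | x , _ , refl = x , ∈W⇒⊆R (proj₁ m) (x∈⁅x⁆ x) , refl
      minimalW : ∃[ x ] (x ∈ R × S ≡ ⁅ x ⁆) → Minimal W S
      minimalW (x , x∈R , refl) =
        minimalV⇒minimalW (λ y∈⁅x⁆ → subst (_∈ R) (sym (x∈⁅y⁆⇒x≡y x y∈⁅x⁆)) x∈R)
                          (from (minimal ⁅ x ⁆) (x , sub R R∈V x∈R , refl))

  levelW⇔ : ∀ i T → Level W i T ⇔ (Level V i T × T ⊆ R)
  levelW⇔ i T = mk⇔ (λ (T∈W , ∣T∣≡) → (∈W⇒∈V T∈W , ∣T∣≡) , ∈W⇒⊆R T∈W)
                    (λ ((T∈V , ∣T∣≡) , T⊆R) → ∈W⁺ T∈V T⊆R , ∣T∣≡)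

  edgeW⇔ : ∀ i T₁ T₂ → Edge W i T₁ T₂ ⇔ (Edge V i T₁ T₂ × T₁ ⊆ R × T₂ ⊆ R)
  edgeW⇔ i T₁ T₂ = mk⇔ edgeV edgeW
    where
      edgeV : Edge W i T₁ T₂ → Edge V i T₁ T₂ × T₁ ⊆ R × T₂ ⊆ R
      edgeV (T₁≢T₂ , S , (S∈W , ∣S∣≡) , S⋗T₁ , S⋗T₂) =
        (T₁≢T₂ , S , (∈W⇒∈V S∈W , ∣S∣≡) , S⋗ᵥT₁ , S⋗ᵥT₂) ,
        ⊆-trans (lower⊆upper S⋗ᵥT₁) (∈W⇒⊆R S∈W) , ⊆-trans (lower⊆upper S⋗ᵥT₂) (∈W⇒⊆R S∈W)
        where
          S⋗ᵥT₁ = coversW⇒coversV S⋗T₁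
          S⋗ᵥT₂ = coversW⇒coversV S⋗T₂
      edgeW : Edge V i T₁ T₂ × T₁ ⊆ R × T₂ ⊆ R → Edge W i T₁ T₂
      edgeW ((T₁≢T₂ , S , (S∈V , ∣S∣≡) , S⋗T₁ , S⋗T₂) , T₁⊆R , T₂⊆R) =
        T₁≢T₂ , S , (∈W⁺ S∈V S⊆R , ∣S∣≡) , coversV⇒coversW S⊆R S⋗T₁ , coversV⇒coversW S⊆R S⋗T₂
        where
          S⊆R : S ⊆ R
          S⊆R = subst (_⊆ R) (sym (covers-union S⋗T₁ S⋗T₂ T₁≢T₂)) (∪-least T₁⊆R T₂⊆R)

  edgeBelow⇒edgeW : ∀ {j T₁ T₂} → EdgeBelow {R} j T₁ T₂ → Edge W j T₁ T₂
  edgeBelow⇒edgeW (T₁≢T₂ , S , (S∈V , ∣S∣≡) , S⋗T₁ , S⋗T₂ , dS) =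
    T₁≢T₂ , S , (∈W⁺ S∈V (descendant⊆ dS) , ∣S∣≡) ,
    coversV⇒coversW (descendant⊆ dS) S⋗T₁ , coversV⇒coversW (descendant⊆ dS) S⋗T₂

  descendant : ∀ {T} → T ∈ᶠ W → Descendant R T
  descendant T∈W = subset-descendant R∈V _ (∈W⇒∈V T∈W) refl (∈W⇒⊆R T∈W)

  levelW-connected : ∀ i → 1 ≤ i → Connected (Level W i) (Edge W i)
  levelW-connected i 1≤i T T' (T∈W , ∣T∣≡) (T'∈W , ∣T'∣≡) =
    reach-map edgeBelow⇒edgeW
      (descendants-connected 1≤i (∈W⇒∈V T∈W , ∣T∣≡) (∈W⇒∈V T'∈W , ∣T'∣≡)
                             (descendant T∈W) (descendant T'∈W))

  levelW-acyclic : ∀ i → 1 ≤ i → i < ∣ R ∣ → Acyclic (Level W i) (Edge W i)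
  levelW-acyclic i 1≤i i<∣R∣ cs cycle =
    proj₂ (trees i 1≤i (<-≤-trans i<∣R∣ ∣R∣≤∣X∣)) cs
      (isCycle-map (proj₁ ∘ to (levelW⇔ i _)) (proj₁ ∘ to (edgeW⇔ i _ _)) cs cycle)

  twoCoversW : ∀ S → S ∈ᶠ W → ¬ Minimal W S →
               ∃[ T₁ ] ∃[ T₂ ] (T₁ ≢ T₂ × Covers W S T₁ × Covers W S T₂
                 × (∀ T → Covers W S T → T ≡ T₁ ⊎ T ≡ T₂))
  twoCoversW S S∈W ¬minW with twoCovers S (∈W⇒∈V S∈W) (¬minW ∘ minimalV⇒minimalW (∈W⇒⊆R S∈W))
  ... | T₁ , T₂ , T₁≢T₂ , S⋗T₁ , S⋗T₂ , only =
    T₁ , T₂ , T₁≢T₂ , coversV⇒coversW (∈W⇒⊆R S∈W) S⋗T₁ , coversV⇒coversW (∈W⇒⊆R S∈W) S⋗T₂ ,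
    λ T → only T ∘ coversW⇒coversV

  proximityW : ∀ i → 2 ≤ i → ∀ T₁ T₂ → Level W i T₁ → Level W i T₂ → T₁ ≢ T₂ →
               ∃[ S ] (Covers W S T₁ × Covers W S T₂) → ∃[ U ] (Covers W T₁ U × Covers W T₂ U)
  proximityW i 2≤i T₁ T₂ lev₁ lev₂ T₁≢T₂ (S , S⋗T₁ , S⋗T₂)
    with to (levelW⇔ i T₁) lev₁ | to (levelW⇔ i T₂) lev₂
  ... | levV₁ , T₁⊆R | levV₂ , T₂⊆R
    with proximity i 2≤i T₁ T₂ levV₁ levV₂ T₁≢T₂ (S , coversW⇒coversV S⋗T₁ , coversW⇒coversV S⋗T₂)
  ... | U , T₁⋗U , T₂⋗U = U , coversV⇒coversW T₁⊆R T₁⋗U , coversV⇒coversW T₂⊆R T₂⋗U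

  isRegularVine : IsRegularVine R W
  isRegularVine = record
    { sub       = λ _ → ∈W⇒⊆R
    ; top       = ∈W⁺ R∈V ⊆-refl
    ; minimal   = minimalW⇔singleton
    ; graded    = λ S T S⋗T → graded S T (coversW⇒coversV S⋗T)
    ; twoCovers = twoCoversW
    ; trees     = λ i 1≤i i<∣R∣ → levelW-connected i 1≤i , levelW-acyclic i 1≤i i<∣R∣
    ; proximity = proximityW
    }

  level-nonempty : ∀ {i} → 1 ≤ i → i ≤ ∣ R ∣ → ∃ (Level W i)
  level-nonempty {suc j} _ i≤∣R∣ =
    descend (∣ R ∣ ∸ suc j) R∈V (trans (sym (m∸n+n≡m i≤∣R∣)) (+-suc _ j)) ⊆-refl
    where
      descend : ∀ d {S} → S ∈ᶠ V → ∣ S ∣ ≡ suc (d + j) → S ⊆ R → ∃ (Level W (suc j))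
      descend zero {S} S∈V ∣S∣≡ S⊆R = S , ∈W⁺ S∈V S⊆R , ∣S∣≡
      descend (suc d) {S} S∈V ∣S∣≡ S⊆R with twoCovers S S∈V (∣∣≡2+⇒¬minimal ∣S∣≡)
      ... | T , _ , _ , S⋗T , _ =
        descend d (lower∈ S⋗T) (proj₂ (covers-level S⋗T ∣S∣≡)) (⊆-trans (lower⊆upper S⋗T) S⊆R)

  isDVine : IsDVine X V → IsDVine R W
  isDVine dvine = record
    { regular = isRegularVine
    ; paths   = λ i 1≤i i<∣R∣ →
        ConnectedInducedSubgraph.isPathGraph (_⊆? R) (levelW⇔ i) (edgeW⇔ i) (levelW-connected i 1≤i)
          (IsDVine.paths dvine i 1≤i (<-≤-trans i<∣R∣ ∣R∣≤∣X∣))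
    }

  isCVine : IsCVine X V → IsCVine R W
  isCVine cvine = record
    { regular = isRegularVine
    ; stars   = λ i 1≤i i<∣R∣ →
        ConnectedInducedSubgraph.isStarGraph (_⊆? R) (levelW⇔ i) (edgeW⇔ i) (levelW-connected i 1≤i)
          (level-nonempty 1≤i (<⇒≤ i<∣R∣))
          (IsCVine.stars cvine i 1≤i (<-≤-trans i<∣R∣ ∣R∣≤∣X∣))
    }

module Coatoms {n : ℕ} {A : Subset n} {V : Family n} (vine : IsRegularVine A V)
               {a₁ a₂ : Fin n} (a₁≢a₂ : a₁ ≢ a₂)
               (A⋗A-a₁ : Covers V A (A - a₁)) (A⋗A-a₂ : Covers V A (A - a₂)) where
  open IsRegularVine vine
  open RegularVineProperties vine

  covers-deletion⇒∈ : ∀ {a} → Covers V A (A - a) → a ∈ A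
  covers-deletion⇒∈ {a} A⋗A-a with lower⊂upper A⋗A-a
  ... | _ , x , x∈A , x∉A-a with x Fin.≟ a
  ...   | yes refl = x∈A
  ...   | no x≢a = contradiction (x∈p∧x≢y⇒x∈p-y x∈A x≢a) x∉A-a

  A-a₁≢A-a₂ : A - a₁ ≢ A - a₂
  A-a₁≢A-a₂ eq = x∈p-y⇒x≢y (subst (a₁ ∈_) (sym eq) (x∈p∧x≢y⇒x∈p-y (covers-deletion⇒∈ A⋗A-a₁) a₁≢a₂)) refl

  ∣A-a₂∣≡∣A-a₁∣ : ∣ A - a₂ ∣ ≡ ∣ A - a₁ ∣
  ∣A-a₂∣≡∣A-a₁∣ = suc-injective (trans (sym (graded _ _ A⋗A-a₂)) (graded _ _ A⋗A-a₁))

  ∣A-a₁-a₂∣<∣A-a₁∣ : ∣ A - a₁ - a₂ ∣ < ∣ A - a₁ ∣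
  ∣A-a₁-a₂∣<∣A-a₁∣ = x∈p⇒∣p-x∣<∣p∣ (x∈p∧x≢y⇒x∈p-y (covers-deletion⇒∈ A⋗A-a₂) (a₁≢a₂ ∘ sym))

  A-a₁-a₂∈V : 3 ≤ ∣ A ∣ → (A - a₁ - a₂) ∈ᶠ V
  A-a₁-a₂∈V 3≤∣A∣
    with proximity ∣ A - a₁ ∣ (≤-pred (subst (3 ≤_) (graded _ _ A⋗A-a₁) 3≤∣A∣)) (A - a₁) (A - a₂)
                   (lower∈ A⋗A-a₁ , refl) (lower∈ A⋗A-a₂ , ∣A-a₂∣≡∣A-a₁∣) A-a₁≢A-a₂ (A , A⋗A-a₁ , A⋗A-a₂)
  ... | U , A-a₁⋗U , A-a₂⋗U = subst (_∈ᶠ V) U≡A-a₁-a₂ (lower∈ A-a₁⋗U)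
    where
      U≡A-a₁-a₂ : U ≡ A - a₁ - a₂
      U≡A-a₁-a₂ = p⊆q∧∣q∣≤∣p∣⇒p≡q (p⊆q-x∧p⊆q-y⇒p⊆q-x-y (lower⊆upper A-a₁⋗U) (lower⊆upper A-a₂⋗U))
                                  (≤-pred (subst (∣ A - a₁ - a₂ ∣ <_) (graded _ _ A-a₁⋗U) ∣A-a₁-a₂∣<∣A-a₁∣))

proposition2p15 : (n : ℕ) (A : Subset n) (V : Family n) (a₁ a₂ : Fin n) →
    2 ≤ ∣ A ∣ → IsRegularVine A V → a₁ ≢ a₂ →
    Covers V A (A - a₁) → Covers V A (A - a₂) →
    ((IsDVine A V →
        IsDVine (A - a₁) (restrict V (A - a₁))
      × IsDVine (A - a₂) (restrict V (A - a₂))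
      × (3 ≤ ∣ A ∣ → IsDVine (A - a₁ - a₂) (restrict (restrict V (A - a₁)) (A - a₂))))
    × (IsCVine A V →
        IsCVine (A - a₁) (restrict V (A - a₁))
      × IsCVine (A - a₂) (restrict V (A - a₂))
      × (3 ≤ ∣ A ∣ → IsCVine (A - a₁ - a₂) (restrict (restrict V (A - a₁)) (A - a₂)))))
proposition2p15 n A V a₁ a₂ _ vine a₁≢a₂ A⋗A-a₁ A⋗A-a₂ =
  (λ dvine → V₁.isDVine dvine , V₂.isDVine dvine , λ 3≤∣A∣ → V₁₂.isDVine 3≤∣A∣ dvine) ,
  (λ cvine → V₁.isCVine cvine , V₂.isCVine cvine , λ 3≤∣A∣ → V₁₂.isCVine 3≤∣A∣ cvine)
  where
    open RegularVineProperties vine using (lower∈)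
    open Coatoms vine a₁≢a₂ A⋗A-a₁ A⋗A-a₂ using (A-a₁-a₂∈V)

    module V₁ = Restriction vine (lower∈ A⋗A-a₁) (∈-restrict⁻ V) (∈-restrict⁺ V)
    module V₂ = Restriction vine (lower∈ A⋗A-a₂) (∈-restrict⁻ V) (∈-restrict⁺ V)
    module V₁₂ (3≤∣A∣ : 3 ≤ ∣ A ∣) = Restriction vine (A-a₁-a₂∈V 3≤∣A∣) (∈-restrict²⁻ V) (∈-restrict²⁺ V)
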